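{- Let $W=\langle K,\le,D,J,v\rangle$ be a prevalent model, $k\in K$, and $F$ a formula context and $B$ a formula such that $F[B]$ is a quantifier-free closed $\mathcal{L}(D)$-formula. Then $k\models_WF[\neg B]$ iff $k\models_WF[\sim B]$.
   Context: Language: $\mathcal{L}$ is a first-order language with $\top,\bot$, connectives $\land,\lor,\to,\neg$ ($\neg$ primitive, distinct from $A\to\bot$), $\forall,\exists$, countably many variables, constants, function and predicate symbols, including a distinguished unary predicate $E$. $\sim A$ abbreviates $A\to\bot$. $\mathcal{L}(D)$ adds constants $\overline d$ for $d\in D$. GN formulas: $N::=\bot\mid\neg A\mid N\land N\mid N\lor N\mid N\to N\mid\forall xN\mid\exists xN$; $\forall xA$/$\exists xA$ is global if $x$ occurs free in $A$ and all its free occurrences lie inside GN subformulas, local otherwise. Formula contexts: $F::=*\mid F\circ A\mid A\circ F\mid\neg F\mid\forall xF\mid\exists xF$ ($\circ\in\{\land,\lor,\to\}$, placeholder $*$ occurring once); $F[C]$ is the result of replacing $*$ by $C$. Strict finitistic model $W=\langle K,\le,D,J,v\rangle$: rooted tree (countable branching, height $\le\omega$), nonempty constant domain $D$, compositional interpretation $J$ of closed $\mathcal{L}(D)$-terms with $J(\overline d)=d$, monotone extensions $P^{v(k)}\subseteq D^n$, strictness (values of all subterms of arguments of an atom true at a node lie in $E$'s extension there), finite verification (finitely many predicates with nonempty extension per node). Forcing: atoms via $v(k)$; $\top$ forced, $\bot$ not; $\land,\lor$ componentwise; $k\models A\to B$ iff every $k'\ge k$ forcing $A$ has some $k''\ge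 k'$ forcing $B$; $k\models\neg A$ iff no node forces $A$; $k\models\forall xA$ iff for all $d$, $k\models\top\to A[\overline d/x]$ (global) or $k\models E(\overline d)\to A[\overline d/x]$ (local); $k\models\exists xA$ iff for some $d$, $k\models A[\overline d/x]$ (global) or $k\models E(\overline d)\land A[\overline d/x]$ (local). $W$ is prevalent if every closed $\mathcal{L}(D)$-formula forced at some node is prevalent (each node has some node above-or-equal forcing it) and $E(\overline d)$ is prevalent for all $d\in D$. -}

module Defs where

open import Data.Nat using (ℕ; _≟_)
open import Data.Bool using (Bool; true; false; _∧_; _∨_; not; if_then_else_)
open import Data.Maybe using (Maybe; just; nothing)
import Data.Maybe as Maybe
open import Data.Vec using (Vec; []; _∷_)
open import Data.Vec.Relation.Unary.Any using (Any)
open import Data.List using (List)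
open import Data.List.Membership.Propositional using (_∈_)
open import Data.Product using (Σ; _×_; _,_)
open import Data.Sum using (_⊎_)
open import Data.Empty using (⊥)
open import Data.Unit using (⊤)
open import Relation.Nullary using (¬_)
open import Relation.Nullary.Decidable using (⌊_⌋)
open import Relation.Binary.PropositionalEquality using (_≡_)
open import Relation.Binary.Structures using (IsPartialOrder)

record Signature : Set₁ where
  field
    Con  : Set
    Fun  : ℕ → Set
    Pred : ℕ → Set
    E    : Pred 1
    conCode      : Con → ℕ
    conCode-inj  : ∀ a b → conCode a ≡ conCode b → a ≡ b
    funCode      : ∀ {n} → Fun n → ℕ
    funCode-inj  : ∀ {n} (a b : Fun n) → funCode a ≡ funCode b → a ≡ b
    predCode     : ∀ {n} → Pred n → ℕ
    predCode-inj : ∀ {n} (a b : Pred n) → predCode a ≡ predCode b → a ≡ b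

Var : Set
Var = ℕ

Env : Set → Set
Env D = Var → Maybe D

_[_↦_] : {D : Set} → Env D → Var → D → Env D
(ρ [ x ↦ d ]) y = if ⌊ y ≟ x ⌋ then just d else ρ y

∅ : {D : Set} → Env D
∅ _ = nothing

-- Terms and formulas of L(X): X is the set of added constants \overline d.
-- L itself is L(⊥); L(D) is Formula S D.

module _ (S : Signature) where
  open Signature S

  data Term (X : Set) : Set where
    var : Var → Term X
    par : X → Term X
    con : Con → Term X
    fun : ∀ {n} → Fun n → Vec (Term X) n → Term X

  infixr 6 _∧ᶠ_
  infixr 5 _∨ᶠ_
  infixr 4 _⇒ᶠ_

  data Formula (X : Set) : Set where
    atom : ∀ {n} → Pred n → Vec (Term X) n → Formula X
    ⊤ᶠ ⊥ᶠ : Formula X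
    _∧ᶠ_ _∨ᶠ_ _⇒ᶠ_ : Formula X → Formula X → Formula X
    ¬ᶠ_ : Formula X → Formula X
    ∀ᶠ ∃ᶠ : Var → Formula X → Formula X

  data _⊑_ {X : Set} (s : Term X) : Term X → Set where
    here  : s ⊑ s
    under : ∀ {n} {f : Fun n} {ts : Vec (Term X) n} → Any (s ⊑_) ts → s ⊑ fun f ts

  data BinOp : Set where
    and or imp : BinOp

  data Ctx (X : Set) : Set where
    ∗     : Ctx X
    _⟨_⟩ˡ_ : Ctx X → BinOp → Formula X → Ctx X
    _⟨_⟩ʳ_ : Formula X → BinOp → Ctx X → Ctx X
    ¬ᶜ_   : Ctx X → Ctx X
    ∀ᶜ ∃ᶜ : Var → Ctx X → Ctx X

module _ {S : Signature} where
  open Signature S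

  ∼_ : {X : Set} → Formula S X → Formula S X
  ∼ A = A ⇒ᶠ ⊥ᶠ

  bin : {X : Set} → BinOp S → Formula S X → Formula S X → Formula S X
  bin and A B = A ∧ᶠ B
  bin or  A B = A ∨ᶠ B
  bin imp A B = A ⇒ᶠ B

  _[_] : {X : Set} → Ctx S X → Formula S X → Formula S X
  ∗ [ C ] = C
  (F ⟨ o ⟩ˡ A) [ C ] = bin o (F [ C ]) A
  (A ⟨ o ⟩ʳ F) [ C ] = bin o A (F [ C ])
  (¬ᶜ F) [ C ] = ¬ᶠ (F [ C ])
  (∀ᶜ x F) [ C ] = ∀ᶠ x (F [ C ])
  (∃ᶜ x F) [ C ] = ∃ᶠ x (F [ C ])

  module _ {X : Set} where
    occursT  : Var → Term S X → Bool
    occursTs : ∀ {n} → Var → Vec (Term S X) n → Bool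
    occursT x (var y) = ⌊ x ≟ y ⌋
    occursT x (par _) = false
    occursT x (con _) = false
    occursT x (fun f ts) = occursTs x ts
    occursTs x [] = false
    occursTs x (t ∷ ts) = occursT x t ∨ occursTs x ts

    freeIn : Var → Formula S X → Bool
    freeIn x (atom P ts) = occursTs x ts
    freeIn x ⊤ᶠ = false
    freeIn x ⊥ᶠ = false
    freeIn x (A ∧ᶠ B) = freeIn x A ∨ freeIn x B
    freeIn x (A ∨ᶠ B) = freeIn x A ∨ freeIn x B
    freeIn x (A ⇒ᶠ B) = freeIn x A ∨ freeIn x B
    freeIn x (¬ᶠ A) = freeIn x A
    freeIn x (∀ᶠ y A) = if ⌊ x ≟ y ⌋ then false else freeIn x A
    freeIn x (∃ᶠ y A) = if ⌊ x ≟ y ⌋ then false else freeIn x A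

    isGN : Formula S X → Bool
    isGN (atom P ts) = false
    isGN ⊤ᶠ = false
    isGN ⊥ᶠ = true
    isGN (A ∧ᶠ B) = isGN A ∧ isGN B
    isGN (A ∨ᶠ B) = isGN A ∧ isGN B
    isGN (A ⇒ᶠ B) = isGN A ∧ isGN B
    isGN (¬ᶠ A) = true
    isGN (∀ᶠ y A) = isGN A
    isGN (∃ᶠ y A) = isGN A

    freeOutsideGN  : Var → Formula S X → Bool
    freeOutsideGN′ : Var → Formula S X → Bool
    freeOutsideGN x A = not (isGN A) ∧ freeOutsideGN′ x A
    freeOutsideGN′ x (atom P ts) = occursTs x ts
    freeOutsideGN′ x ⊤ᶠ = false
    freeOutsideGN′ x ⊥ᶠ = false
    freeOutsideGN′ x (A ∧ᶠ B) = freeOutsideGN x A ∨ freeOutsideGN x B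
    freeOutsideGN′ x (A ∨ᶠ B) = freeOutsideGN x A ∨ freeOutsideGN x B
    freeOutsideGN′ x (A ⇒ᶠ B) = freeOutsideGN x A ∨ freeOutsideGN x B
    freeOutsideGN′ x (¬ᶠ A) = freeOutsideGN x A
    freeOutsideGN′ x (∀ᶠ y A) = if ⌊ x ≟ y ⌋ then false else freeOutsideGN x A
    freeOutsideGN′ x (∃ᶠ y A) = if ⌊ x ≟ y ⌋ then false else freeOutsideGN x A

    -- ∀xA / ∃xA is global iff x occurs free in A and all its free
    -- occurrences lie inside GN subformulas; local otherwise
    isGlobal : Var → Formula S X → Bool
    isGlobal x A = freeIn x A ∧ not (freeOutsideGN x A)

    Closed : Formula S X → Set
    Closed A = ∀ x → freeIn x A ≡ false

    quantifierFree : Formula S X → Bool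
    quantifierFree (atom P ts) = true
    quantifierFree ⊤ᶠ = true
    quantifierFree ⊥ᶠ = true
    quantifierFree (A ∧ᶠ B) = quantifierFree A ∧ quantifierFree B
    quantifierFree (A ∨ᶠ B) = quantifierFree A ∧ quantifierFree B
    quantifierFree (A ⇒ᶠ B) = quantifierFree A ∧ quantifierFree B
    quantifierFree (¬ᶠ A) = quantifierFree A
    quantifierFree (∀ᶠ y A) = false
    quantifierFree (∃ᶠ y A) = false

    QuantifierFree : Formula S X → Set
    QuantifierFree A = quantifierFree A ≡ true

  -- Evaluation of L(D)-terms, given interpretations of the constant and
  -- function symbols (this is the compositional J, with J(\overline d) = d),
  -- relative to an assignment of the free variables (used only to
  -- implement substitution A[\overline d / x] in the forcing clauses).

  module Eval {D : Set} (conI : Con → D) (funI : ∀ {n} → Fun n → Vec D n → D) where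
    eval  : Env D → Term S D → Maybe D
    evals : ∀ {n} → Env D → Vec (Term S D) n → Maybe (Vec D n)
    eval ρ (var x) = ρ x
    eval ρ (par d) = just d
    eval ρ (con c) = just (conI c)
    eval ρ (fun f ts) = Maybe.map (funI f) (evals ρ ts)
    evals ρ [] = just []
    evals ρ (t ∷ ts) with eval ρ t | evals ρ ts
    ... | just d | just ds = just (d ∷ ds)
    ... | _      | _       = nothing

    -- J on closed terms (J t ≡ just (value) exactly for closed t)
    J : Term S D → Maybe D
    J = eval ∅

    Js : ∀ {n} → Vec (Term S D) n → Maybe (Vec D n)
    Js = evals ∅

ImmSucc : {K : Set} → (K → K → Set) → K → K → Set
ImmSucc _≤_ k k' = (k ≤ k') × ¬ (k ≡ k') × (∀ m → k ≤ m → m ≤ k' → (m ≡ k) ⊎ (m ≡ k'))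

record Model (S : Signature) : Set₁ where
  open Signature S
  field
    K    : Set
    _≤_  : K → K → Set
    ≤-po : IsPartialOrder _≡_ _≤_
    root : K
    root-least : ∀ k → root ≤ k
    tree : ∀ {a b k} → a ≤ k → b ≤ k → (a ≤ b) ⊎ (b ≤ a)
    finite-height : ∀ k → Σ (List K) λ ps → ∀ a → a ≤ k → a ∈ ps
    countable-branching : ∀ k → Σ (K → ℕ) λ c →
      ∀ a b → ImmSucc _≤_ k a → ImmSucc _≤_ k b → c a ≡ c b → a ≡ b
    D  : Set
    d₀ : D
    conI : Con → D
    funI : ∀ {n} → Fun n → Vec D n → D
    v    : K → ∀ {n} → Pred n → Vec D n → Set
    mono : ∀ {k k' n} (P : Pred n) (ds : Vec D n) → k ≤ k' → v k P ds → v k' P ds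
    strict : ∀ k {n} (P : Pred n) (ts : Vec (Term S D) n) (ds : Vec D n) →
      Eval.Js {S} conI funI ts ≡ just ds → v k P ds →
      ∀ s → Any (λ t → _⊑_ S s t) ts → ∀ e → Eval.J {S} conI funI s ≡ just e → v k E (e ∷ [])
    finite-verification : ∀ k → Σ (List (Σ ℕ Pred)) λ ps →
      ∀ {n} (P : Pred n) (ds : Vec D n) → v k P ds → (n , P) ∈ ps

module _ {S : Signature} (W : Model S) where
  open Signature S
  open Model W
  open Eval {S} conI funI

  Imp : K → (K → Set) → (K → Set) → Set
  Imp k P Q = ∀ k' → k ≤ k' → P k' → Σ K λ k'' → (k' ≤ k'') × Q k''

  AtomForce : K → ∀ {n} → Pred n → Vec (Term S D) n → Env D → Set
  AtomForce k P ts ρ = Σ (Vec D _) λ ds → (evals ρ ts ≡ just ds) × v k P ds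

  -- k ⊩[ ρ ] A  is forcing of A with the substitution ρ applied to its
  -- free variables; ρ [ x ↦ d ] implements A[\overline d / x].
  _⊩[_]_ : K → Env D → Formula S D → Set
  k ⊩[ ρ ] atom P ts = AtomForce k P ts ρ
  k ⊩[ ρ ] ⊤ᶠ = ⊤
  k ⊩[ ρ ] ⊥ᶠ = ⊥
  k ⊩[ ρ ] (A ∧ᶠ B) = (k ⊩[ ρ ] A) × (k ⊩[ ρ ] B)
  k ⊩[ ρ ] (A ∨ᶠ B) = (k ⊩[ ρ ] A) ⊎ (k ⊩[ ρ ] B)
  k ⊩[ ρ ] (A ⇒ᶠ B) = Imp k (λ k' → k' ⊩[ ρ ] A) (λ k'' → k'' ⊩[ ρ ] B)
  k ⊩[ ρ ] (¬ᶠ A) = ∀ k' → ¬ (k' ⊩[ ρ ] A)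
  k ⊩[ ρ ] (∀ᶠ x A) = if isGlobal x A
    then (∀ d → Imp k (λ _ → ⊤) (λ k'' → k'' ⊩[ ρ [ x ↦ d ] ] A))
    else (∀ d → Imp k (λ k' → AtomForce k' E (par d ∷ []) ρ) (λ k'' → k'' ⊩[ ρ [ x ↦ d ] ] A))
  k ⊩[ ρ ] (∃ᶠ x A) = if isGlobal x A
    then (Σ D λ d → k ⊩[ ρ [ x ↦ d ] ] A)
    else (Σ D λ d → AtomForce k E (par d ∷ []) ρ × (k ⊩[ ρ [ x ↦ d ] ] A))

  _⊩_ : K → Formula S D → Set
  k ⊩ A = k ⊩[ ∅ ] A

  PrevalentFormula : Formula S D → Set
  PrevalentFormula A = ∀ k → Σ K λ k' → (k ≤ k') × (k' ⊩ A)

Prevalent : {S : Signature} → Model S → Set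
Prevalent {S} W =
  (∀ (A : Formula S D) → Closed A → (Σ K λ k → _⊩_ W k A) → PrevalentFormula W A)
  × (∀ (d : D) → PrevalentFormula W (atom (Signature.E S) (par d ∷ [])))
  where open Model W

{-# OPTIONS --safe #-}
module Submission where

open import Defs
open import Data.Bool using (_∧_; _∨_; true; false)
open import Data.Bool.Properties using (∧-conicalˡ; ∧-conicalʳ; ∨-conicalˡ; ∨-conicalʳ)
open import Data.Empty using (⊥; ⊥-elim)
open import Data.Product using (Σ; _×_; _,_; proj₁; proj₂; map₂)
open import Data.Product.Function.NonDependent.Propositional using (_×-⇔_)
open import Data.Sum.Function.Propositional using (_⊎-⇔_)
open import Data.Unit using (⊤)
open import Function using (_∘_)
open import Function.Bundles using (_⇔_; mk⇔; Equivalence)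
open import Function.Construct.Identity using (⇔-id)
open import Relation.Binary.PropositionalEquality using (_≡_)

-- A closed formula of a prevalent model that is forced somewhere is forced
-- above every node, so ¬ B ("B is forced nowhere") and ∼ B ("B is forced
-- nowhere above here") hold at the same nodes.  Outside quantifiers, forcing
-- of F[C] depends only on where C is forced, so the two may be exchanged in F.

∧-true : ∀ {x y} → x ∧ y ≡ true → x ≡ true × y ≡ true
∧-true x∧y = ∧-conicalˡ _ _ x∧y , ∧-conicalʳ _ _ x∧y

∨-false : ∀ {x y} → x ∨ y ≡ false → x ≡ false × y ≡ false
∨-false x∨y = ∨-conicalˡ _ _ x∨y , ∨-conicalʳ _ _ x∨y

module _ {S : Signature} {X : Set} where

  BinderFree : Ctx S X → Set
  BinderFree ∗ = ⊤
  BinderFree (F ⟨ _ ⟩ˡ _) = BinderFree F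
  BinderFree (_ ⟨ _ ⟩ʳ F) = BinderFree F
  BinderFree (¬ᶜ F) = BinderFree F
  BinderFree (∀ᶜ _ _) = ⊥
  BinderFree (∃ᶜ _ _) = ⊥

  quantifierFree-bin : ∀ o {A B : Formula S X} →
    QuantifierFree (bin o A B) → QuantifierFree A × QuantifierFree B
  quantifierFree-bin and = ∧-true
  quantifierFree-bin or  = ∧-true
  quantifierFree-bin imp = ∧-true

  closed-bin : ∀ o {A B : Formula S X} → Closed (bin o A B) → Closed A × Closed B
  closed-bin and c = proj₁ ∘ ∨-false ∘ c , proj₂ ∘ ∨-false ∘ c
  closed-bin or  c = proj₁ ∘ ∨-false ∘ c , proj₂ ∘ ∨-false ∘ c
  closed-bin imp c = proj₁ ∘ ∨-false ∘ c , proj₂ ∘ ∨-false ∘ c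

  quantifierFree-plug⇒binderFree : ∀ F {B : Formula S X} →
    QuantifierFree (F [ B ]) → BinderFree F
  quantifierFree-plug⇒binderFree ∗ _ = _
  quantifierFree-plug⇒binderFree (F ⟨ o ⟩ˡ _) qf =
    quantifierFree-plug⇒binderFree F (proj₁ (quantifierFree-bin o qf))
  quantifierFree-plug⇒binderFree (_ ⟨ o ⟩ʳ F) qf =
    quantifierFree-plug⇒binderFree F (proj₂ (quantifierFree-bin o qf))
  quantifierFree-plug⇒binderFree (¬ᶜ F) qf = quantifierFree-plug⇒binderFree F qf
  quantifierFree-plug⇒binderFree (∀ᶜ _ _) ()
  quantifierFree-plug⇒binderFree (∃ᶜ _ _) ()

  closed-plug : ∀ F {B : Formula S X} → BinderFree F → Closed (F [ B ]) → Closed B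
  closed-plug ∗ _ c = c
  closed-plug (F ⟨ o ⟩ˡ _) bf c = closed-plug F bf (proj₁ (closed-bin o c))
  closed-plug (_ ⟨ o ⟩ʳ F) bf c = closed-plug F bf (proj₂ (closed-bin o c))
  closed-plug (¬ᶜ F) bf c = closed-plug F bf c

module _ {S : Signature} (W : Model S) where
  open Model W
  open Equivalence

  ForcingEquivalent : Env D → Formula S D → Formula S D → Set
  ForcingEquivalent ρ A B = ∀ k → (_⊩[_]_ W k ρ A) ⇔ (_⊩[_]_ W k ρ B)

  Imp-map : ∀ {P P′ Q Q′ : K → Set} {k} →
    (∀ {m} → P′ m → P m) → (∀ {m} → Q m → Q′ m) → Imp W k P Q → Imp W k P′ Q′
  Imp-map P′⇒P Q⇒Q′ P⇒Q k′ k≤k′ = map₂ (map₂ Q⇒Q′) ∘ P⇒Q k′ k≤k′ ∘ P′⇒P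

  Imp-cong : ∀ {P P′ Q Q′ : K → Set} {k} →
    (∀ m → P m ⇔ P′ m) → (∀ m → Q m ⇔ Q′ m) → Imp W k P Q ⇔ Imp W k P′ Q′
  Imp-cong P⇔P′ Q⇔Q′ = mk⇔ (Imp-map (from (P⇔P′ _)) (to (Q⇔Q′ _)))
                           (Imp-map (to (P⇔P′ _)) (from (Q⇔Q′ _)))

  ⊩-bin-cong : ∀ {ρ} o {A A′ B B′} → ForcingEquivalent ρ A A′ → ForcingEquivalent ρ B B′ →
    ForcingEquivalent ρ (bin o A B) (bin o A′ B′)
  ⊩-bin-cong and A≈A′ B≈B′ k = A≈A′ k ×-⇔ B≈B′ k
  ⊩-bin-cong or  A≈A′ B≈B′ k = A≈A′ k ⊎-⇔ B≈B′ k
  ⊩-bin-cong imp A≈A′ B≈B′ k = Imp-cong A≈A′ B≈B′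

  ⊩-¬-cong : ∀ {ρ A A′} → ForcingEquivalent ρ A A′ → ForcingEquivalent ρ (¬ᶠ A) (¬ᶠ A′)
  ⊩-¬-cong A≈A′ k = mk⇔ (λ ¬A m → ¬A m ∘ from (A≈A′ m)) (λ ¬A′ m → ¬A′ m ∘ to (A≈A′ m))

  -- Under a quantifier this fails: whether ∀x / ∃x is global depends on the
  -- syntax of the body, e.g. ¬ B is always GN but ∼ B need not be.
  ⊩-plug-cong : ∀ ρ F {C C′} → BinderFree F →
    ForcingEquivalent ρ C C′ → ForcingEquivalent ρ (F [ C ]) (F [ C′ ])
  ⊩-plug-cong ρ ∗ _ C≈C′ = C≈C′
  ⊩-plug-cong ρ (F ⟨ o ⟩ˡ A) {C} {C′} bf C≈C′ =
    ⊩-bin-cong {ρ} o {F [ C ]} {F [ C′ ]} {A} {A} (⊩-plug-cong ρ F bf C≈C′) (λ _ → ⇔-id _)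
  ⊩-plug-cong ρ (A ⟨ o ⟩ʳ F) {C} {C′} bf C≈C′ =
    ⊩-bin-cong {ρ} o {A} {A} {F [ C ]} {F [ C′ ]} (λ _ → ⇔-id _) (⊩-plug-cong ρ F bf C≈C′)
  ⊩-plug-cong ρ (¬ᶜ F) {C} {C′} bf C≈C′ =
    ⊩-¬-cong {ρ} {F [ C ]} {F [ C′ ]} (⊩-plug-cong ρ F bf C≈C′)

  ⊩¬⇔⊩∼ : ∀ B → ((Σ K λ m → _⊩_ W m B) → PrevalentFormula W B) →
    ForcingEquivalent ∅ (¬ᶠ B) (∼ B)
  ⊩¬⇔⊩∼ B forced⇒prevalent k = mk⇔ ¬⇒∼ ∼⇒¬
    where
    ¬⇒∼ : _⊩_ W k (¬ᶠ B) → _⊩_ W k (∼ B)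
    ¬⇒∼ ¬B k′ _ B′ = ⊥-elim (¬B k′ B′)

    ∼⇒¬ : _⊩_ W k (∼ B) → _⊩_ W k (¬ᶠ B)
    ∼⇒¬ ∼B m Bₘ with forced⇒prevalent (m , Bₘ) k
    ... | k′ , k≤k′ , B′ = proj₂ (proj₂ (∼B k′ k≤k′ B′))

mainTheorem18 : (S : Signature) (W : Model S) → Prevalent W →
    (k : Model.K W) (F : Ctx S (Model.D W)) (B : Formula S (Model.D W)) →
    QuantifierFree (F [ B ]) → Closed (F [ B ]) →
    (_⊩_ W k (F [ ¬ᶠ B ])) ⇔ (_⊩_ W k (F [ ∼ B ]))
mainTheorem18 S W (closed-prevalent , _) k F B qf closed =
  ⊩-plug-cong W ∅ F binderFree (⊩¬⇔⊩∼ W B (closed-prevalent B closedB)) k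
  where
  binderFree : BinderFree F
  binderFree = quantifierFree-plug⇒binderFree F qf

  closedB : Closed B
  closedB = closed-plug F binderFree closed
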